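{- For every context $\Gamma$, formula $A$ and every (co)term $N$ of $\overline{\lambda}^{co}$: $N\in\mathcal{S}(\Gamma\Rightarrow A)$ (membership) iff $\Gamma\vdash N:A$ holds in $\overline{\lambda}^{co}$.
   Context: Formulas are built from atoms by implication $\supset$ (associating to the right); contexts are finite lists of declarations $x:A$ with distinct variables. The (co)terms of $\overline{\lambda}^{co}$ are generated coinductively by $N::=_{co}\lambda x^A.N\mid x\langle N_1,\dots,N_k\rangle$; typing in $\overline{\lambda}^{co}$ is the greatest relation closed under: from $\Gamma,x:A\vdash N:B$ infer $\Gamma\vdash\lambda x^A.N:A\supset B$; from $(x:B_1\supset\cdots\supset B_k\supset p)\in\Gamma$ ($p$ an atom) and $\Gamma\vdash N_i:B_i$ for $i=1..k$ infer $\Gamma\vdash x\langle N_1,\dots,N_k\rangle:p$. Böhm forests and elimination alternatives are generated coinductively by $N::=_{co}\lambda x^A.N\mid E_1+\cdots+E_n$, $E::=_{co}x\langle N_1,\dots,N_k\rangle$ ($n,k\ge0$; empty sum $\mathbb{O}$). The solution space is the Böhm forest defined corecursively by $\mathcal{S}(\Gamma\Rightarrow A\supset B)=\lambda x^A.\mathcal{S}(\Gamma,x:A\Rightarrow B)$ ($x$ fresh) and $\mathcal{S}(\Gamma\Rightarrow p)=\sum_{(y:B_1\supset\cdots\supset B_k\supset p)\in\Gamma}y\langle\mathcal{S}(\Gamma\Rightarrow B_1),\dots,\mathcal{S}(\Gamma\Rightarrow B_k)\rangle$ for $p$ an atom. Membership relations $M\in N$ (between a $\overline{\lambda}^{co}$-(co)term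 and a Böhm forest) and $M\in E$ (between a $\overline{\lambda}^{co}$-(co)term and an elimination alternative) are the greatest relations closed under: from $M\in N$ infer $\lambda x^A.M\in\lambda x^A.N$; from $M\in E_i$ for some $i$ infer $M\in E_1+\cdots+E_n$; from $M_i\in N_i$ for all $i=1..k$ infer $x\langle M_1,\dots,M_k\rangle\in x\langle N_1,\dots,N_k\rangle$. -}

module Defs where

-- Conventions:
-- * bound variables are de Bruijn indices, so (co)terms and forests are
--   taken up to renaming of bound variables; contexts are lists of formulas
--   (the most recent declaration has index 0), so "distinct variables" is
--   automatic and "x fresh" needs no choice.
-- * coinductive objects (coterms, Böhm forests) are represented by pointed
--   coalgebras of the corresponding signature functor (a state space, a
--   one-step unfolding, a root state); every element of the final
--   coalgebra arises this way.
-- * greatest relations are given by Knaster–Tarski: a pair is related iff it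
--   lies in some relation R that is backward closed (post-fixed) under the
--   rules, i.e. every R-related pair is the conclusion of a rule instance
--   whose premises are R-related.

open import Data.Nat using (ℕ; zero; suc)
open import Data.Nat.Properties using (_≟_)
open import Data.Product using (Σ; _×_; _,_)
open import Data.List using (List; []; _∷_; foldr; map)
open import Data.List.Relation.Unary.Any using (Any)
open import Data.List.Relation.Binary.Pointwise using (Pointwise)
open import Relation.Nullary using (yes; no)

Atom : Set
Atom = ℕ

infixr 6 _⊃_
data Form : Set where
  atom : Atom → Form
  _⊃_  : Form → Form → Form

_⇒*_ : List Form → Atom → Form
Bs ⇒* p = foldr _⊃_ (atom p) Bs

-- every formula A is uniquely  args A ⇒* target A
args : Form → List Form
args (atom p) = []
args (A ⊃ B)  = A ∷ args B

target : Form → Atom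
target (atom p) = p
target (A ⊃ B)  = target B

Ctx : Set
Ctx = List Form

data _∋_∶_ : Ctx → ℕ → Form → Set where
  here  : ∀ {Γ A} → (A ∷ Γ) ∋ zero ∶ A
  there : ∀ {Γ A B x} → Γ ∋ x ∶ A → (B ∷ Γ) ∋ suc x ∶ A

-- (Co)terms of λ̄co:  N ::=co λ^A.N | x⟨N₁,…,Nₖ⟩

data TermF (X : Set) : Set where
  lam : Form → X → TermF X
  app : ℕ → List X → TermF X

record Term : Set₁ where
  field
    St   : Set
    step : St → TermF St
    root : St

data TyStep {X : Set} (R : Ctx → X → Form → Set) (Γ : Ctx) :
            TermF X → Form → Set where
  lam : ∀ {A B n} → R (A ∷ Γ) n B → TyStep R Γ (lam A n) (A ⊃ B)
  app : ∀ {x Bs p ns} → Γ ∋ x ∶ (Bs ⇒* p) →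
        Pointwise (λ n B → R Γ n B) ns Bs → TyStep R Γ (app x ns) (atom p)

_⊢_∶_ : Ctx → Term → Form → Set₁
Γ ⊢ N ∶ A =
  Σ (Ctx → St → Form → Set) λ R →
    (∀ Δ s B → R Δ s B → TyStep R Δ (step s) B) × R Γ root A
  where open Term N

-- Böhm forests  N ::=co λ^A.N | E₁+⋯+Eₙ ,  E ::=co x⟨N₁,…,Nₖ⟩

data ElimF (X : Set) : Set where
  elim : ℕ → List X → ElimF X

data ForestF (X : Set) : Set where
  lam : Form → X → ForestF X
  sum : List (ElimF X) → ForestF X

record Forest : Set₁ where
  field
    St   : Set
    step : St → ForestF St
    root : St

-- Solution space S(Γ ⇒ A); the state (Δ , B) stands for S(Δ ⇒ B)

-- alternatives y⟨S(Γ⇒B₁),…,S(Γ⇒Bₖ)⟩ for the declarations y : B₁⊃⋯⊃Bₖ⊃p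
-- of Γ; the last argument is the suffix of Γ still to scan, at index i
alts : Ctx → Atom → ℕ → Ctx → List (ElimF (Ctx × Form))
alts Γ p i [] = []
alts Γ p i (B ∷ Δ) with target B ≟ p
... | yes _ = elim i (map (λ C → (Γ , C)) (args B)) ∷ alts Γ p (suc i) Δ
... | no _  = alts Γ p (suc i) Δ

solStep : Ctx × Form → ForestF (Ctx × Form)
solStep (Γ , A ⊃ B)  = lam A (A ∷ Γ , B)
solStep (Γ , atom p) = sum (alts Γ p zero Γ)

S : Ctx → Form → Forest
S Γ A = record { St = Ctx × Form ; step = solStep ; root = (Γ , A) }

module _ {X Y : Set} (R : X → Y → Set) where
  data MemE : TermF X → ElimF Y → Set where
    app : ∀ {x ms ns} → Pointwise R ms ns → MemE (app x ms) (elim x ns)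

  data MemStep : TermF X → ForestF Y → Set where
    lam : ∀ {A m n} → R m n → MemStep (lam A m) (lam A n)
    sum : ∀ {t Es} → Any (MemE t) Es → MemStep t (sum Es)

_∈F_ : Term → Forest → Set₁
M ∈F N =
  Σ (M.St → N.St → Set) λ R →
    (∀ m n → R m n → MemStep R (M.step m) (N.step n)) × R M.root N.root
  where
    module M = Term M
    module N = Forest N

-- The solution space unfolds exactly like the typing rules: at an implication
-- it is a λ with the context extended, and at an atom p it is the sum of the
-- alternatives y⟨S(Γ⇒B₁),…,S(Γ⇒Bₖ)⟩, one for each declaration y : B₁⊃⋯⊃Bₖ⊃p
-- of Γ.  So, identifying the forest state (Γ , A) with the judgement Γ ⊢ _ ∶ A,
-- one membership step is exactly one typing step; hence every post-fixed
-- relation for membership is one for typing and conversely, and the two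
-- greatest relations agree.
module Submission where

open import Defs
open import Function.Bundles using (_⇔_; mk⇔)
open import Data.Nat using (ℕ; zero; suc; _+_)
open import Data.Nat.Properties using (_≟_; +-suc; +-identityʳ)
open import Data.Product using (∃₂; _×_; _,_)
open import Data.List using ([]; _∷_; map)
open import Data.List.Relation.Unary.Any using (Any; here; there)
open import Data.List.Relation.Binary.Pointwise using (Pointwise; []; _∷_)
open import Relation.Nullary using (yes; no; contradiction)
open import Relation.Binary.PropositionalEquality using (_≡_; refl; sym; subst)

args-⇒* : ∀ Bs p → args (Bs ⇒* p) ≡ Bs
args-⇒* []       p = refl
args-⇒* (B ∷ Bs) p rewrite args-⇒* Bs p = refl

target-⇒* : ∀ Bs p → target (Bs ⇒* p) ≡ p
target-⇒* []       p = refl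
target-⇒* (B ∷ Bs) p = target-⇒* Bs p

args-⇒*-target : ∀ B → args B ⇒* target B ≡ B
args-⇒*-target (atom p) = refl
args-⇒*-target (A ⊃ B) rewrite args-⇒*-target B = refl

module _ {A B C : Set} {R : A → C → Set} {g : B → C} where

  Pointwise-mapʳ⁺ : ∀ {xs ys} →
    Pointwise (λ x y → R x (g y)) xs ys → Pointwise R xs (map g ys)
  Pointwise-mapʳ⁺ []       = []
  Pointwise-mapʳ⁺ (r ∷ rs) = r ∷ Pointwise-mapʳ⁺ rs

  Pointwise-mapʳ⁻ : ∀ {xs ys} →
    Pointwise R xs (map g ys) → Pointwise (λ x y → R x (g y)) xs ys
  Pointwise-mapʳ⁻ {ys = []}    []       = []
  Pointwise-mapʳ⁻ {ys = _ ∷ _} (r ∷ rs) = r ∷ Pointwise-mapʳ⁻ rs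

MemRel TyRel : Set → Set₁
MemRel X = X → Ctx × Form → Set
TyRel  X = Ctx → X → Form → Set

toTyRel : ∀ {X} → MemRel X → TyRel X
toTyRel R Δ s B = R s (Δ , B)

toMemRel : ∀ {X} → TyRel X → MemRel X
toMemRel R s (Δ , B) = R Δ s B

module _ {X : Set} {R : MemRel X} {Γ : Ctx} {p : Atom} where

  MatchingDecl : TermF X → ℕ → Ctx → Set
  MatchingDecl t i Δ = ∃₂ λ j B → Δ ∋ j ∶ B × target B ≡ p ×
                       MemE R t (elim (i + j) (map (Γ ,_) (args B)))

  MatchingDecl-there : ∀ {t i B Δ} →
    MatchingDecl t (suc i) Δ → MatchingDecl t i (B ∷ Δ)
  MatchingDecl-there {t} {i} (j , C , x∶C , eq , t∈E) =
    suc j , C , there x∶C , eq ,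
    subst (λ x → MemE R t (elim x (map (Γ ,_) (args C)))) (sym (+-suc i j)) t∈E

  alts⁻ : ∀ {t} i Δ → Any (MemE R t) (alts Γ p i Δ) → MatchingDecl t i Δ
  alts⁻ i (B ∷ Δ) t∈ with target B ≟ p
  alts⁻ {t} i (B ∷ Δ) (here t∈E) | yes eq =
    zero , B , here , eq ,
    subst (λ x → MemE R t (elim x (map (Γ ,_) (args B)))) (sym (+-identityʳ i)) t∈E
  alts⁻ i (B ∷ Δ) (there t∈) | yes _  = MatchingDecl-there (alts⁻ (suc i) Δ t∈)
  alts⁻ i (B ∷ Δ) t∈         | no _   = MatchingDecl-there (alts⁻ (suc i) Δ t∈)

  alts⁺ : ∀ {Bs ns} i Δ j → Δ ∋ j ∶ (Bs ⇒* p) →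
    Pointwise (λ n C → R n (Γ , C)) ns Bs →
    Any (MemE R (app (i + j) ns)) (alts Γ p i Δ)
  alts⁺ {Bs} i (B ∷ Δ) zero here ns∈ with target (Bs ⇒* p) ≟ p
  ... | no ¬eq = contradiction (target-⇒* Bs p) ¬eq
  ... | yes _ rewrite +-identityʳ i | args-⇒* Bs p = here (app (Pointwise-mapʳ⁺ ns∈))
  alts⁺ i (B ∷ Δ) (suc j) (there x∶A) ns∈ rewrite +-suc i j
    with target B ≟ p
  ... | yes _ = there (alts⁺ (suc i) Δ j x∶A ns∈)
  ... | no _  = alts⁺ (suc i) Δ j x∶A ns∈

module _ {X : Set} where

  MemStep⇒TyStep : ∀ {R : MemRel X} Δ B t →
    MemStep R t (solStep (Δ , B)) → TyStep (toTyRel R) Δ t B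
  MemStep⇒TyStep Δ (A ⊃ B) (lam A n) (lam n∈) = lam n∈
  MemStep⇒TyStep Δ (atom p) t (sum t∈) with alts⁻ zero Δ t∈
  ... | x , C , x∶C , refl , app ns∈ =
    app (subst (Δ ∋ x ∶_) (sym (args-⇒*-target C)) x∶C) (Pointwise-mapʳ⁻ ns∈)

  TyStep⇒MemStep : ∀ {R : TyRel X} Δ B t →
    TyStep R Δ t B → MemStep (toMemRel R) t (solStep (Δ , B))
  TyStep⇒MemStep Δ (A ⊃ B)  (lam A n)  (lam ⊢n)       = lam ⊢n
  TyStep⇒MemStep Δ (atom p) (app x ns) (app x∶A ⊢ns) = sum (alts⁺ zero Δ x x∶A ⊢ns)

∈S⇒⊢ : ∀ Γ A N → N ∈F S Γ A → Γ ⊢ N ∶ A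
∈S⇒⊢ Γ A N (R , post , r) =
  toTyRel R , (λ Δ s B r′ → MemStep⇒TyStep Δ B (Term.step N s) (post s (Δ , B) r′)) , r

⊢⇒∈S : ∀ Γ A N → Γ ⊢ N ∶ A → N ∈F S Γ A
⊢⇒∈S Γ A N (R , post , r) =
  toMemRel R , (λ { s (Δ , B) r′ → TyStep⇒MemStep Δ B (Term.step N s) (post Δ s B r′) }) , r

proposition12 : (Γ : Ctx) (A : Form) (N : Term) →
                (N ∈F S Γ A) ⇔ (Γ ⊢ N ∶ A)
proposition12 Γ A N = mk⇔ (∈S⇒⊢ Γ A N) (⊢⇒∈S Γ A N)
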